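{- Let $\mathbf A$ be an MV(I)-algebra, $x,y\in A$, $Y\subseteq A$, and $X=\{(1,y): y\in Y\}$. Then (1) $\mathfrak f_{\mathsf{Cg}^{\mathbf A}(x,y)}=\mathsf{Fg}^{\mathbf A}(x\ast y)=\mathsf{Fg}^{\mathbf A}(x\leftrightarrow y)$; (2) $\mathfrak f_{\mathsf{Cg}^{\mathbf A}(X)}=\mathsf{Fg}^{\mathbf A}(Y)$.
   Context: An MV(I)-algebra is an MV-algebra with, for each $\Box$ in a set $I$ of unary symbols, a unary operation $\Box$ that is a $\{\wedge,\cdot,0,1\}$-endomorphism. An I-filter is a nonempty up-set closed under $\cdot$ and under each $\Box\in I$. For a congruence $\theta$, $\mathfrak f_\theta=1/\theta$. $\mathsf{Fg}^{\mathbf A}(Z)$ denotes the least I-filter containing $Z$ (with $\mathsf{Fg}^{\mathbf A}(z)=\mathsf{Fg}^{\mathbf A}(\{z\})$), and $\mathsf{Cg}^{\mathbf A}(x,y)$, $\mathsf{Cg}^{\mathbf A}(X)$ the congruence generated by $(x,y)$, resp. by the set of pairs $X$. $x\ast y=(x\to y)(y\to x)$, $x\leftrightarrow y=(x\to y)\wedge(y\to x)$. -}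

module Defs where

open import Level using (Level; _⊔_; suc)
open import Relation.Binary.PropositionalEquality using (_≡_)
open import Relation.Unary using (Pred)
open import Data.Product using (_×_)

record MVAlgebra (a : Level) : Set (suc a) where
  infixl 6 _⊕_
  field
    Carrier : Set a
    _⊕_     : Carrier → Carrier → Carrier
    ¬_      : Carrier → Carrier
    𝟘       : Carrier
    ⊕-assoc : ∀ x y z → (x ⊕ y) ⊕ z ≡ x ⊕ (y ⊕ z)
    ⊕-comm  : ∀ x y → x ⊕ y ≡ y ⊕ x
    ⊕-idʳ   : ∀ x → x ⊕ 𝟘 ≡ x
    ¬¬      : ∀ x → ¬ (¬ x) ≡ x
    ⊕-absorb : ∀ x → x ⊕ ¬ 𝟘 ≡ ¬ 𝟘
    łuk     : ∀ x y → ¬ (¬ x ⊕ y) ⊕ y ≡ ¬ (¬ y ⊕ x) ⊕ x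

  𝟙 : Carrier
  𝟙 = ¬ 𝟘

  infixl 7 _·_
  _·_ : Carrier → Carrier → Carrier
  x · y = ¬ (¬ x ⊕ ¬ y)

  infixr 5 _⇒_
  _⇒_ : Carrier → Carrier → Carrier
  x ⇒ y = ¬ x ⊕ y

  _∧_ : Carrier → Carrier → Carrier
  x ∧ y = x · (¬ x ⊕ y)

  _∨_ : Carrier → Carrier → Carrier
  x ∨ y = ¬ (¬ x ⊕ y) ⊕ y

  _≤_ : Carrier → Carrier → Set a
  x ≤ y = x ∧ y ≡ x

  _∗_ : Carrier → Carrier → Carrier
  x ∗ y = (x ⇒ y) · (y ⇒ x)

  _⇔_ : Carrier → Carrier → Carrier
  x ⇔ y = (x ⇒ y) ∧ (y ⇒ x)

record MVIAlgebra (i a : Level) : Set (suc (i ⊔ a)) where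
  field
    mv : MVAlgebra a
  open MVAlgebra mv public
  field
    I     : Set i
    □     : I → Carrier → Carrier
    □-∧   : ∀ j x y → □ j (x ∧ y) ≡ □ j x ∧ □ j y
    □-·   : ∀ j x y → □ j (x · y) ≡ □ j x · □ j y
    □-𝟘   : ∀ j → □ j 𝟘 ≡ 𝟘
    □-𝟙   : ∀ j → □ j 𝟙 ≡ 𝟙

module _ {i a : Level} (𝐀 : MVIAlgebra i a) where
  open MVIAlgebra 𝐀

  -- Fg(Z): least I-filter (nonempty up-set closed under · and every □) containing Z,
  -- given as an inductively generated subset.
  data Fg {ℓ : Level} (Z : Pred Carrier ℓ) : Pred Carrier (i ⊔ a ⊔ ℓ) where
    fg-base : ∀ {z} → Z z → Fg Z z
    fg-one  : Fg Z 𝟙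
    fg-up   : ∀ {x y} → Fg Z x → x ≤ y → Fg Z y
    fg-mul  : ∀ {x y} → Fg Z x → Fg Z y → Fg Z (x · y)
    fg-box  : ∀ j {x} → Fg Z x → Fg Z (□ j x)

  -- Cg(X): least congruence of the MV(I)-algebra (equivalence relation compatible
  -- with ⊕, ¬, 0 and every □) containing the set of pairs X.
  data Cg {ℓ : Level} (X : Carrier → Carrier → Set ℓ) : Carrier → Carrier → Set (i ⊔ a ⊔ ℓ) where
    cg-base  : ∀ {x y} → X x y → Cg X x y
    cg-refl  : ∀ {x} → Cg X x x
    cg-sym   : ∀ {x y} → Cg X x y → Cg X y x
    cg-trans : ∀ {x y z} → Cg X x y → Cg X y z → Cg X x z
    cg-⊕     : ∀ {x x' y y'} → Cg X x x' → Cg X y y' → Cg X (x ⊕ y) (x' ⊕ y')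
    cg-¬     : ∀ {x x'} → Cg X x x' → Cg X (¬ x) (¬ x')
    cg-box   : ∀ j {x x'} → Cg X x x' → Cg X (□ j x) (□ j x')

  𝔣 : {ℓ : Level} → (Carrier → Carrier → Set ℓ) → Pred Carrier ℓ
  𝔣 θ z = θ 𝟙 z

  Cg₂ : Carrier → Carrier → Carrier → Carrier → Set (i ⊔ a)
  Cg₂ x y = Cg (λ u v → (u ≡ x) × (v ≡ y))

  Fg₁ : Carrier → Pred Carrier (i ⊔ a)
  Fg₁ z = Fg (_≡ z)

  pairsFrom1 : {ℓ : Level} → Pred Carrier ℓ → Carrier → Carrier → Set (a ⊔ ℓ)
  pairsFrom1 Y u v = (u ≡ 𝟙) × Y v

-- Order an MV-algebra by x ≼ y iff x ⇒ y = 𝟙. For an I-filter F, the relation "u ∗ v ∈ F"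
-- is a congruence: u ∗ u = 𝟙, and the products (u ∗ v)·(v ∗ w), (u ∗ u')·(v ∗ v') and
-- □ (u ∗ v) lie below u ∗ w, (u ⊕ v) ∗ (u' ⊕ v') and □ u ∗ □ v, while ¬ u ∗ ¬ v = u ∗ v.
-- Conversely the class 1/θ of any congruence θ is an I-filter, because u ≤ v gives
-- v = u ∨ v θ 𝟙 ∨ v = 𝟙. Hence 1/Cg(X) = Fg{u ∗ v : (u,v) ∈ X}, and 𝟙 ∗ y = y. Finally
-- x ∗ y and x ⇔ y generate the same filter since (x ⇔ y)·(x ⇔ y) ≼ x ∗ y ≼ x ⇔ y.
module Submission where

open import Defs
open import Level using (Level)
open import Relation.Unary using (Pred; _⊆_; _≐_)
open import Data.Product using (_×_; _,_)
open import Relation.Binary.PropositionalEquality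
  using (_≡_; refl; sym; trans; cong; cong₂; subst; subst₂; module ≡-Reasoning)
open import Relation.Binary.PropositionalEquality.Algebra using (isMagma)
open import Algebra.Bundles using (CommutativeSemigroup)
import Algebra.Properties.CommutativeSemigroup as CommutativeSemigroupProperties

module MVProperties {a : Level} (M : MVAlgebra a) where
  open MVAlgebra M
  open ≡-Reasoning

  infix 4 _≼_
  _≼_ : Carrier → Carrier → Set a
  x ≼ y = x ⇒ y ≡ 𝟙

  ¬𝟙≡𝟘 : ¬ 𝟙 ≡ 𝟘
  ¬𝟙≡𝟘 = ¬¬ 𝟘

  ⊕-idˡ : ∀ x → 𝟘 ⊕ x ≡ x
  ⊕-idˡ x = trans (⊕-comm 𝟘 x) (⊕-idʳ x)

  ⊕-zeroˡ : ∀ x → 𝟙 ⊕ x ≡ 𝟙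
  ⊕-zeroˡ x = trans (⊕-comm 𝟙 x) (⊕-absorb x)

  ⇒-idˡ : ∀ x → 𝟙 ⇒ x ≡ x
  ⇒-idˡ x = trans (cong (_⊕ x) ¬𝟙≡𝟘) (⊕-idˡ x)

  ⇒-refl : ∀ x → x ⇒ x ≡ 𝟙
  ⇒-refl x = sym (begin
    𝟙                 ≡⟨ sym (⊕-absorb _) ⟩
    ¬ (¬ x ⊕ 𝟙) ⊕ 𝟙   ≡⟨ łuk x 𝟙 ⟩
    ¬ (𝟙 ⇒ x) ⊕ x     ≡⟨ cong (λ t → ¬ t ⊕ x) (⇒-idˡ x) ⟩
    ¬ x ⊕ x           ∎)

  ·-idʳ : ∀ x → x · 𝟙 ≡ x
  ·-idʳ x = trans (cong (λ t → ¬ (¬ x ⊕ t)) ¬𝟙≡𝟘) (trans (cong ¬_ (⊕-idʳ (¬ x))) (¬¬ x))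

  ·-comm : ∀ x y → x · y ≡ y · x
  ·-comm x y = cong ¬_ (⊕-comm (¬ x) (¬ y))

  ·-assoc : ∀ x y z → (x · y) · z ≡ x · (y · z)
  ·-assoc x y z = cong ¬_ (begin
    ¬ (¬ (¬ x ⊕ ¬ y)) ⊕ ¬ z   ≡⟨ cong (_⊕ ¬ z) (¬¬ _) ⟩
    (¬ x ⊕ ¬ y) ⊕ ¬ z         ≡⟨ ⊕-assoc _ _ _ ⟩
    ¬ x ⊕ (¬ y ⊕ ¬ z)         ≡⟨ cong (¬ x ⊕_) (sym (¬¬ _)) ⟩
    ¬ x ⊕ ¬ (¬ (¬ y ⊕ ¬ z))   ∎)

  ·-commutativeSemigroup : CommutativeSemigroup a a
  ·-commutativeSemigroup = record
    { isCommutativeSemigroup = record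
      { isSemigroup = record { isMagma = isMagma _·_ ; assoc = ·-assoc }
      ; comm        = ·-comm
      }
    }

  open CommutativeSemigroupProperties ·-commutativeSemigroup using () renaming (interchange to ·-interchange)

  ∗-refl : ∀ x → x ∗ x ≡ 𝟙
  ∗-refl x = trans (cong₂ _·_ (⇒-refl x) (⇒-refl x)) (·-idʳ 𝟙)

  ∗-idˡ : ∀ x → 𝟙 ∗ x ≡ x
  ∗-idˡ x = trans (cong₂ _·_ (⇒-idˡ x) (⊕-absorb (¬ x))) (·-idʳ x)

  ∗-sym : ∀ x y → x ∗ y ≡ y ∗ x
  ∗-sym x y = ·-comm _ _

  ≼-respˡ-≡ : ∀ {x x' y} → x ≡ x' → x' ≼ y → x ≼ y
  ≼-respˡ-≡ refl p = p

  ≼-respʳ-≡ : ∀ {x y y'} → x ≼ y → y ≡ y' → x ≼ y'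
  ≼-respʳ-≡ p refl = p

  ≼⇒≡⊕ : ∀ {x y} → x ≼ y → y ≡ x ⊕ ¬ (¬ y ⊕ x)
  ≼⇒≡⊕ {x} {y} p = begin
    y                 ≡⟨ sym (⊕-idˡ y) ⟩
    𝟘 ⊕ y             ≡⟨ cong (_⊕ y) (sym ¬𝟙≡𝟘) ⟩
    ¬ 𝟙 ⊕ y           ≡⟨ cong (λ t → ¬ t ⊕ y) (sym p) ⟩
    ¬ (¬ x ⊕ y) ⊕ y   ≡⟨ łuk x y ⟩
    ¬ (¬ y ⊕ x) ⊕ x   ≡⟨ ⊕-comm _ _ ⟩
    x ⊕ ¬ (¬ y ⊕ x)   ∎

  ≡⊕⇒≼ : ∀ {x y} d → y ≡ x ⊕ d → x ≼ y
  ≡⊕⇒≼ {x} {y} d e = begin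
    ¬ x ⊕ y         ≡⟨ cong (¬ x ⊕_) e ⟩
    ¬ x ⊕ (x ⊕ d)   ≡⟨ sym (⊕-assoc _ _ _) ⟩
    (¬ x ⊕ x) ⊕ d   ≡⟨ cong (_⊕ d) (⇒-refl x) ⟩
    𝟙 ⊕ d           ≡⟨ ⊕-zeroˡ d ⟩
    𝟙               ∎

  ≼-trans : ∀ {x y z} → x ≼ y → y ≼ z → x ≼ z
  ≼-trans {x} {y} {z} p q = ≡⊕⇒≼ _ (begin
    z                                        ≡⟨ ≼⇒≡⊕ q ⟩
    y ⊕ ¬ (¬ z ⊕ y)                          ≡⟨ cong (_⊕ ¬ (¬ z ⊕ y)) (≼⇒≡⊕ p) ⟩
    (x ⊕ ¬ (¬ y ⊕ x)) ⊕ ¬ (¬ z ⊕ y)          ≡⟨ ⊕-assoc _ _ _ ⟩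
    x ⊕ (¬ (¬ y ⊕ x) ⊕ ¬ (¬ z ⊕ y))          ∎)

  ⊕-monoˡ-≼ : ∀ {x y} c → x ≼ y → x ⊕ c ≼ y ⊕ c
  ⊕-monoˡ-≼ {x} {y} c p = ≡⊕⇒≼ d (begin
    y ⊕ c         ≡⟨ cong (_⊕ c) (≼⇒≡⊕ p) ⟩
    (x ⊕ d) ⊕ c   ≡⟨ ⊕-assoc _ _ _ ⟩
    x ⊕ (d ⊕ c)   ≡⟨ cong (x ⊕_) (⊕-comm _ _) ⟩
    x ⊕ (c ⊕ d)   ≡⟨ sym (⊕-assoc _ _ _) ⟩
    (x ⊕ c) ⊕ d   ∎)
    where d = ¬ (¬ y ⊕ x)

  ¬-antitone : ∀ {x y} → x ≼ y → ¬ y ≼ ¬ x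
  ¬-antitone {x} {y} p = trans (cong (_⊕ ¬ x) (¬¬ y)) (trans (⊕-comm _ _) p)

  ·-monoˡ-≼ : ∀ {x y} c → x ≼ y → x · c ≼ y · c
  ·-monoˡ-≼ c p = ¬-antitone (⊕-monoˡ-≼ (¬ c) (¬-antitone p))

  ·-mono-≼ : ∀ {x y u v} → x ≼ y → u ≼ v → x · u ≼ y · v
  ·-mono-≼ {x} {y} {u} {v} p q =
    ≼-trans (·-monoˡ-≼ u p) (≼-respˡ-≡ (·-comm y u) (≼-respʳ-≡ (·-monoˡ-≼ y q) (·-comm v y)))

  x·y≼x : ∀ x y → x · y ≼ x
  x·y≼x x y = ≼-respʳ-≡ (¬-antitone (≡⊕⇒≼ (¬ y) refl)) (¬¬ x)

  x·[x⇒y]≼y : ∀ x y → x · (x ⇒ y) ≼ y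
  x·[x⇒y]≼y x y = begin
    ¬ (¬ (¬ x ⊕ ¬ (¬ x ⊕ y))) ⊕ y   ≡⟨ cong (_⊕ y) (¬¬ _) ⟩
    (¬ x ⊕ ¬ (¬ x ⊕ y)) ⊕ y         ≡⟨ ⊕-assoc _ _ _ ⟩
    ¬ x ⊕ (¬ (¬ x ⊕ y) ⊕ y)         ≡⟨ cong (¬ x ⊕_) (łuk x y) ⟩
    ¬ x ⊕ (¬ (¬ y ⊕ x) ⊕ x)         ≡⟨ cong (¬ x ⊕_) (⊕-comm _ _) ⟩
    ¬ x ⊕ (x ⊕ ¬ (¬ y ⊕ x))         ≡⟨ sym (⊕-assoc _ _ _) ⟩
    (¬ x ⊕ x) ⊕ ¬ (¬ y ⊕ x)         ≡⟨ cong (_⊕ ¬ (¬ y ⊕ x)) (⇒-refl x) ⟩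
    𝟙 ⊕ ¬ (¬ y ⊕ x)                 ≡⟨ ⊕-zeroˡ _ ⟩
    𝟙                               ∎

  ·-residual : ∀ {x y z} → x · y ≼ z → x ≼ y ⇒ z
  ·-residual {x} {y} {z} p = trans (sym (trans (cong (_⊕ z) (¬¬ _)) (⊕-assoc _ _ _))) p

  ≤⇒≼ : ∀ {x y} → x ≤ y → x ≼ y
  ≤⇒≼ {x} {y} e = ≼-respˡ-≡ (sym e) (x·[x⇒y]≼y x y)

  ≼⇒≤ : ∀ {x y} → x ≼ y → x ≤ y
  ≼⇒≤ {x} {y} p = trans (cong (x ·_) p) (·-idʳ x)

  ≼⇒∨≡ : ∀ {x y} → x ≼ y → x ∨ y ≡ y
  ≼⇒∨≡ {y = y} p = trans (cong (λ t → ¬ t ⊕ y) p) (⇒-idˡ y)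

  𝟙∨≡𝟙 : ∀ y → 𝟙 ∨ y ≡ 𝟙
  𝟙∨≡𝟙 y = trans (cong (λ t → ¬ t ⊕ y) (⇒-idˡ y)) (⇒-refl y)

  ⇒-trans : ∀ x y z → (x ⇒ y) · (y ⇒ z) ≼ x ⇒ z
  ⇒-trans x y z = ·-residual (≼-respˡ-≡ reorder (≼-trans (·-monoˡ-≼ (y ⇒ z) (x·[x⇒y]≼y x y)) (x·[x⇒y]≼y y z)))
    where
    reorder : ((x ⇒ y) · (y ⇒ z)) · x ≡ (x · (x ⇒ y)) · (y ⇒ z)
    reorder = trans (·-comm _ _) (sym (·-assoc _ _ _))

  ¬≼[⊕]⇒ : ∀ u v → ¬ u ≼ (u ⊕ v) ⇒ v
  ¬≼[⊕]⇒ u v = ≡⊕⇒≼ (¬ (¬ v ⊕ ¬ u)) (begin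
    ¬ (u ⊕ v) ⊕ v           ≡⟨ cong (λ t → ¬ (t ⊕ v) ⊕ v) (sym (¬¬ u)) ⟩
    ¬ (¬ (¬ u) ⊕ v) ⊕ v     ≡⟨ łuk (¬ u) v ⟩
    ¬ (¬ v ⊕ ¬ u) ⊕ ¬ u     ≡⟨ ⊕-comm _ _ ⟩
    ¬ u ⊕ ¬ (¬ v ⊕ ¬ u)     ∎)

  ⊕-congʳ-⇒ : ∀ u u' v → u ⇒ u' ≼ (u ⊕ v) ⇒ (u' ⊕ v)
  ⊕-congʳ-⇒ u u' v = ≼-respʳ-≡ (⊕-monoˡ-≼ u' (¬≼[⊕]⇒ u v)) (begin
    (¬ (u ⊕ v) ⊕ v) ⊕ u'   ≡⟨ ⊕-assoc _ _ _ ⟩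
    ¬ (u ⊕ v) ⊕ (v ⊕ u')   ≡⟨ cong (¬ (u ⊕ v) ⊕_) (⊕-comm _ _) ⟩
    ¬ (u ⊕ v) ⊕ (u' ⊕ v)   ∎)

  ⊕-congˡ-⇒ : ∀ v v' u → v ⇒ v' ≼ (u ⊕ v) ⇒ (u ⊕ v')
  ⊕-congˡ-⇒ v v' u = ≼-respʳ-≡ (⊕-congʳ-⇒ v v' u) (cong₂ (λ s t → ¬ s ⊕ t) (⊕-comm v u) (⊕-comm v' u))

  ⊕-cong-⇒ : ∀ u u' v v' → (u ⇒ u') · (v ⇒ v') ≼ (u ⊕ v) ⇒ (u' ⊕ v')
  ⊕-cong-⇒ u u' v v' = ≼-trans (·-mono-≼ (⊕-congʳ-⇒ u u' v) (⊕-congˡ-⇒ v v' u')) (⇒-trans _ _ _)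

  ∗-trans : ∀ u v w → (u ∗ v) · (v ∗ w) ≼ u ∗ w
  ∗-trans u v w = ≼-respˡ-≡ (·-interchange _ _ _ _)
    (·-mono-≼ (⇒-trans u v w) (≼-respˡ-≡ (·-comm _ _) (⇒-trans w v u)))

  ⊕-cong-∗ : ∀ u u' v v' → (u ∗ u') · (v ∗ v') ≼ (u ⊕ v) ∗ (u' ⊕ v')
  ⊕-cong-∗ u u' v v' = ≼-respˡ-≡ (·-interchange _ _ _ _)
    (·-mono-≼ (⊕-cong-⇒ u u' v v') (⊕-cong-⇒ u' u v' v))

  ¬-cong-∗ : ∀ u v → (¬ u) ∗ (¬ v) ≡ u ∗ v
  ¬-cong-∗ u v = trans (cong₂ _·_ (¬⇒¬ u v) (¬⇒¬ v u)) (·-comm _ _)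
    where
    ¬⇒¬ : ∀ u v → ¬ u ⇒ ¬ v ≡ v ⇒ u
    ¬⇒¬ u v = trans (cong (_⊕ ¬ v) (¬¬ u)) (⊕-comm _ _)

  ∗≼⇔ : ∀ x y → x ∗ y ≼ x ⇔ y
  ∗≼⇔ x y = ·-mono-≼ (⇒-refl (x ⇒ y)) (≡⊕⇒≼ (¬ (x ⇒ y)) (⊕-comm _ _))

  ⇔·⇔≼∗ : ∀ x y → (x ⇔ y) · (x ⇔ y) ≼ x ∗ y
  ⇔·⇔≼∗ x y = ·-mono-≼ (x·y≼x _ _) (x·[x⇒y]≼y _ _)

module MVIProperties {i a : Level} (𝐀 : MVIAlgebra i a) where
  open MVIAlgebra 𝐀
  open MVProperties mv

  □-cong-⇒ : ∀ j u v → □ j (u ⇒ v) ≼ □ j u ⇒ □ j v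
  □-cong-⇒ j u v = ·-residual (≼-respˡ-≡ □-meet (x·[x⇒y]≼y (□ j u) (□ j v)))
    where
    □-meet : □ j (u ⇒ v) · □ j u ≡ □ j u · (□ j u ⇒ □ j v)
    □-meet = trans (·-comm _ _) (trans (sym (□-· j u (u ⇒ v))) (□-∧ j u v))

  □-cong-∗ : ∀ j u v → □ j (u ∗ v) ≼ □ j u ∗ □ j v
  □-cong-∗ j u v = ≼-respˡ-≡ (□-· j _ _) (·-mono-≼ (□-cong-⇒ j u v) (□-cong-⇒ j v u))

  Fg-up-≼ : ∀ {ℓ} {Z : Pred Carrier ℓ} {x y} → Fg 𝐀 Z x → x ≼ y → Fg 𝐀 Z y
  Fg-up-≼ f p = fg-up f (≼⇒≤ p)

  Fg-least : ∀ {ℓ ℓ'} {Z : Pred Carrier ℓ} {Z' : Pred Carrier ℓ'} → Z ⊆ Fg 𝐀 Z' → Fg 𝐀 Z ⊆ Fg 𝐀 Z'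
  Fg-least h (fg-base z)  = h z
  Fg-least h fg-one       = fg-one
  Fg-least h (fg-up f p)  = fg-up (Fg-least h f) p
  Fg-least h (fg-mul f g) = fg-mul (Fg-least h f) (Fg-least h g)
  Fg-least h (fg-box j f) = fg-box j (Fg-least h f)

  Fg₁-≐ : ∀ {x y} → y · y ≼ x → x ≼ y → Fg₁ 𝐀 x ≐ Fg₁ 𝐀 y
  Fg₁-≐ y·y≼x x≼y =
      Fg-least (λ { refl → Fg-up-≼ (fg-mul (fg-base refl) (fg-base refl)) y·y≼x })
    , Fg-least (λ { refl → Fg-up-≼ (fg-base refl) x≼y })

  Cg⇒Fg-∗ : ∀ {ℓ ℓ'} {Z : Pred Carrier ℓ} {X : Carrier → Carrier → Set ℓ'} →
    (∀ {u v} → X u v → Fg 𝐀 Z (u ∗ v)) → ∀ {u v} → Cg 𝐀 X u v → Fg 𝐀 Z (u ∗ v)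
  Cg⇒Fg-∗ h (cg-base x)                 = h x
  Cg⇒Fg-∗ h (cg-refl {x})               = subst (Fg 𝐀 _) (sym (∗-refl x)) fg-one
  Cg⇒Fg-∗ h (cg-sym {x} {y} c)          = subst (Fg 𝐀 _) (∗-sym x y) (Cg⇒Fg-∗ h c)
  Cg⇒Fg-∗ h (cg-trans {x} {y} {z} c d)  = Fg-up-≼ (fg-mul (Cg⇒Fg-∗ h c) (Cg⇒Fg-∗ h d)) (∗-trans x y z)
  Cg⇒Fg-∗ h (cg-⊕ c d)                  = Fg-up-≼ (fg-mul (Cg⇒Fg-∗ h c) (Cg⇒Fg-∗ h d)) (⊕-cong-∗ _ _ _ _)
  Cg⇒Fg-∗ h (cg-¬ {x} {x'} c)           = subst (Fg 𝐀 _) (sym (¬-cong-∗ x x')) (Cg⇒Fg-∗ h c)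
  Cg⇒Fg-∗ h (cg-box j {x} {x'} c)       = Fg-up-≼ (fg-box j (Cg⇒Fg-∗ h c)) (□-cong-∗ j x x')

  module _ {ℓ} {X : Carrier → Carrier → Set ℓ} where

    Cg-· : ∀ {x x' y y'} → Cg 𝐀 X x x' → Cg 𝐀 X y y' → Cg 𝐀 X (x · y) (x' · y')
    Cg-· c d = cg-¬ (cg-⊕ (cg-¬ c) (cg-¬ d))

    Cg-⇒ : ∀ {x x' y y'} → Cg 𝐀 X x x' → Cg 𝐀 X y y' → Cg 𝐀 X (x ⇒ y) (x' ⇒ y')
    Cg-⇒ c d = cg-⊕ (cg-¬ c) d

    Cg-∗ : ∀ {x x' y y'} → Cg 𝐀 X x x' → Cg 𝐀 X y y' → Cg 𝐀 X (x ∗ y) (x' ∗ y')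
    Cg-∗ c d = Cg-· (Cg-⇒ c d) (Cg-⇒ d c)

    Cg-∨ : ∀ {x x' y y'} → Cg 𝐀 X x x' → Cg 𝐀 X y y' → Cg 𝐀 X (x ∨ y) (x' ∨ y')
    Cg-∨ c d = cg-⊕ (cg-¬ (Cg-⇒ c d)) d

    Fg⊆𝔣Cg : ∀ {ℓ'} {Z : Pred Carrier ℓ'} → Z ⊆ 𝔣 𝐀 (Cg 𝐀 X) → Fg 𝐀 Z ⊆ 𝔣 𝐀 (Cg 𝐀 X)
    Fg⊆𝔣Cg h (fg-base z)           = h z
    Fg⊆𝔣Cg h fg-one                = cg-refl
    Fg⊆𝔣Cg h (fg-up {u} {v} f u≤v) = subst₂ (Cg 𝐀 X) (𝟙∨≡𝟙 v) (≼⇒∨≡ (≤⇒≼ u≤v)) (Cg-∨ (Fg⊆𝔣Cg h f) cg-refl)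
    Fg⊆𝔣Cg h (fg-mul f g)          = subst₂ (Cg 𝐀 X) (·-idʳ 𝟙) refl (Cg-· (Fg⊆𝔣Cg h f) (Fg⊆𝔣Cg h g))
    Fg⊆𝔣Cg h (fg-box j f)          = subst₂ (Cg 𝐀 X) (□-𝟙 j) refl (cg-box j (Fg⊆𝔣Cg h f))

    𝔣Cg≐Fg : ∀ {ℓ'} {Z : Pred Carrier ℓ'} →
      (∀ {u v} → X u v → Fg 𝐀 Z (u ∗ v)) → Z ⊆ 𝔣 𝐀 (Cg 𝐀 X) → 𝔣 𝐀 (Cg 𝐀 X) ≐ Fg 𝐀 Z
    𝔣Cg≐Fg X⊆∗Fg Z⊆𝔣Cg =
        (λ {z} c → subst (Fg 𝐀 _) (∗-idˡ z) (Cg⇒Fg-∗ X⊆∗Fg c))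
      , Fg⊆𝔣Cg Z⊆𝔣Cg

lemma6 : {i a ℓ : Level} (𝐀 : MVIAlgebra i a) →
    let open MVIAlgebra 𝐀 in
    (∀ (x y : Carrier) →
        (𝔣 𝐀 (Cg₂ 𝐀 x y) ≐ Fg₁ 𝐀 (x ∗ y)) × (Fg₁ 𝐀 (x ∗ y) ≐ Fg₁ 𝐀 (x ⇔ y)))
    × (∀ (Y : Pred Carrier ℓ) → 𝔣 𝐀 (Cg 𝐀 (pairsFrom1 𝐀 Y)) ≐ Fg 𝐀 Y)
lemma6 𝐀 = principal , generatedBy1
  where
  open MVIAlgebra 𝐀
  open MVProperties mv
  open MVIProperties 𝐀

  principal : ∀ x y → (𝔣 𝐀 (Cg₂ 𝐀 x y) ≐ Fg₁ 𝐀 (x ∗ y)) × (Fg₁ 𝐀 (x ∗ y) ≐ Fg₁ 𝐀 (x ⇔ y))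
  principal x y =
      𝔣Cg≐Fg (λ { (refl , refl) → fg-base refl })
             (λ { refl → subst₂ (Cg 𝐀 _) (∗-refl x) refl (Cg-∗ cg-refl (cg-base (refl , refl))) })
    , Fg₁-≐ (⇔·⇔≼∗ x y) (∗≼⇔ x y)

  generatedBy1 : ∀ Y → 𝔣 𝐀 (Cg 𝐀 (pairsFrom1 𝐀 Y)) ≐ Fg 𝐀 Y
  generatedBy1 Y =
    𝔣Cg≐Fg (λ { (refl , y) → subst (Fg 𝐀 Y) (sym (∗-idˡ _)) (fg-base y) })
           (λ y → cg-base (refl , y))
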